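{- Let $i\in[d]$, let $v\in\mathbb{R}^{V(Q_d)}$, let $A=A(Q_d)$ and let $\bar v=C_{\{i\},\emptyset}(v)$, i.e. for $S\subseteq[d]$, $$\bar v_S=\begin{cases}\max(v_S,v_{S\cup\{i\}}) & i\notin S,\\ \min(v_S,v_{S\setminus\{i\}}) & i\in S.\end{cases}$$ Then $\langle Av,v\rangle\le\langle A\bar v,\bar v\rangle$.
   Context: $Q_d$ is the $d$-dimensional hypercube with vertex set the subsets of $[d]=\{1,\dots,d\}$, two vertices adjacent iff their symmetric difference has size one; $A(Q_d)$ is its adjacency matrix and $\langle\cdot,\cdot\rangle$ is the standard inner product on $\mathbb{R}^{V(Q_d)}$. -}

module Defs where

open import Level using (Level; _⊔_) renaming (suc to lsuc)
open import Data.Nat using (ℕ; zero; suc)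
open import Data.Nat.Properties using (_≟_)
open import Data.Bool using (Bool; true; false)
open import Data.Vec using (Vec; []; _∷_; lookup)
open import Data.List using (List; []; _∷_; _++_; map; foldr)
open import Data.Fin using (Fin)
open import Data.Fin.Subset using (Subset; inside; outside; ⁅_⁆; _∪_; _─_; ∣_∣)
open import Data.Product using (Σ; ∃; _×_; _,_)
open import Data.Sum using (_⊎_; inj₁; inj₂)
open import Relation.Nullary using (¬_; yes; no)
open import Relation.Binary using (Rel)
open import Relation.Binary.Structures using (IsTotalOrder)
open import Algebra.Bundles using (CommutativeRing)

-- The real numbers, axiomatised as a Dedekind-complete ordered field
-- (any two such structures are isomorphic, so quantifying over all of
-- them is the same as speaking about ℝ).

record RealField (c ℓ : Level) : Set (lsuc (c ⊔ ℓ)) where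
  field
    commRing : CommutativeRing c ℓ
  open CommutativeRing commRing public
  field
    _≤_          : Rel Carrier ℓ
    ≤-isTotalOrder : IsTotalOrder _≈_ _≤_
    +-mono-≤     : ∀ {x y} z → x ≤ y → (x + z) ≤ (y + z)
    *-nonneg     : ∀ {x y} → 0# ≤ x → 0# ≤ y → 0# ≤ (x * y)
    1≉0          : ¬ (1# ≈ 0#)
    inverse      : ∀ x → ¬ (x ≈ 0#) → ∃ λ y → (x * y) ≈ 1#
    lub          : (P : Carrier → Set c) → (∃ λ x → P x) →
                   (∃ λ b → ∀ x → P x → x ≤ b) →
                   ∃ λ s → (∀ x → P x → x ≤ s) ×
                           (∀ b → (∀ x → P x → x ≤ b) → s ≤ b)
  open IsTotalOrder ≤-isTotalOrder public using (total)

  max : Carrier → Carrier → Carrier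
  max x y with total x y
  ... | inj₁ _ = y
  ... | inj₂ _ = x

  min : Carrier → Carrier → Carrier
  min x y with total x y
  ... | inj₁ _ = x
  ... | inj₂ _ = y

-- The hypercube Q_d: vertices are subsets of [d] (= Subset d).

allSubsets : (d : ℕ) → List (Subset d)
allSubsets zero    = [] ∷ []
allSubsets (suc d) = map (outside ∷_) (allSubsets d) ++ map (inside ∷_) (allSubsets d)

_△_ : ∀ {d} → Subset d → Subset d → Subset d
S △ T = (S ─ T) ∪ (T ─ S)

module Cube {c ℓ : Level} (R : RealField c ℓ) where
  open RealField R

  Σv : (d : ℕ) → (Subset d → Carrier) → Carrier
  Σv d f = foldr (λ S acc → f S + acc) 0# (allSubsets d)

  A : ∀ {d} → Subset d → Subset d → Carrier
  A S T with ∣ S △ T ∣ ≟ 1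
  ... | yes _ = 1#
  ... | no  _ = 0#

  mulA : (d : ℕ) → (Subset d → Carrier) → (Subset d → Carrier)
  mulA d v S = Σv d (λ T → A S T * v T)

  ⟨_,_⟩ : ∀ {d} → (Subset d → Carrier) → (Subset d → Carrier) → Carrier
  ⟨_,_⟩ {d} x y = Σv d (λ S → x S * y S)

  compress : (d : ℕ) → Fin d → (Subset d → Carrier) → (Subset d → Carrier)
  compress d i v S with lookup S i
  ... | false = max (v S) (v (S ∪ ⁅ i ⁆))
  ... | true  = min (v S) (v (S ─ ⁅ i ⁆))

-- Split a vector v on Q_{d+1} along the first coordinate into its restrictions v₀, v₁ to the
-- two facets.  Since A(Q_{d+1}) = [[A(Q_d), I], [I, A(Q_d)]], the form q(v) = ⟨Av, v⟩ equals
-- q(v₀) + q(v₁) + 2⟨v₀, v₁⟩, and everything then rests on the rearrangement inequality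
-- x u + y w ≤ max x y · max u w + min x y · min u w.
-- If i is the first coordinate, the compression replaces (v₀, v₁) by (v₀ ⊔ v₁, v₀ ⊓ v₁).  The
-- cross term is unchanged since max x y · min x y = x y, and q(a) + q(b) ≤ q(a ⊔ b) + q(a ⊓ b)
-- follows by induction on d from the splitting and rearrangement.  Otherwise the compression
-- acts on each facet separately: induction handles q(v₀) and q(v₁), and rearrangement (again by
-- induction) gives ⟨a, b⟩ ≤ ⟨C a, C b⟩ for the cross term.
module Submission where

open import Defs
open import Level using (Level)
open import Data.Nat using (ℕ; zero; suc)
open import Data.Nat.Properties using (_≟_)
open import Data.Fin using (Fin; zero; suc)
open import Data.Fin.Subset using (Subset; inside; outside; ∣_∣)
open import Data.Fin.Subset.Properties using (∪-identityʳ; p─⊥≡p)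
open import Data.Vec using (_∷_; []; lookup)
open import Data.Bool using (not)
open import Data.List using (List; []; _∷_; _++_; map; foldr)
open import Data.List.Properties using (foldr-map)
open import Data.Sum using (inj₁; inj₂)
open import Data.Empty using (⊥-elim)
open import Relation.Nullary using (yes; no)
open import Relation.Binary.Bundles using (Poset)
open import Relation.Binary.Structures using (IsTotalOrder)
open import Relation.Binary.PropositionalEquality as ≡ using (_≡_; _≢_)
import Algebra.Properties.AbelianGroup as AbelianGroupProperties
import Algebra.Properties.CommutativeSemigroup as CommutativeSemigroupProperties
import Algebra.Solver.Ring.NaturalCoefficients.Default as NaturalCoefficientSolver
import Relation.Binary.Reasoning.PartialOrder as PartialOrderReasoning
import Relation.Binary.Reasoning.Setoid as SetoidReasoning

lower upper : ∀ {a} {X : Set a} {d} → (Subset (suc d) → X) → Subset d → X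
lower v S = v (outside ∷ S)
upper v S = v (inside ∷ S)

module Compression {c ℓ : Level} (R : RealField c ℓ) where
  open RealField R hiding (zero)
  open Cube R
  open IsTotalOrder ≤-isTotalOrder using (isPartialOrder; antisym)
    renaming (refl to ≤-refl; reflexive to ≤-reflexive; trans to ≤-trans)
  open AbelianGroupProperties +-abelianGroup using (xyx⁻¹≈y)
  open CommutativeSemigroupProperties +-commutativeSemigroup using (interchange)
  open NaturalCoefficientSolver commutativeSemiring using (solve; _:+_; _:*_; _:=_)

  ≤-poset : Poset c ℓ ℓ
  ≤-poset = record { isPartialOrder = isPartialOrder }

  module ≤-Reasoning = PartialOrderReasoning ≤-poset
  module ≈-Reasoning = SetoidReasoning setoid

  +-mono₂-≤ : ∀ {x y u w} → x ≤ y → u ≤ w → (x + u) ≤ (y + w)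
  +-mono₂-≤ {x} {y} {u} {w} x≤y u≤w = begin
    x + u  ≤⟨ +-mono-≤ u x≤y ⟩
    y + u  ≈⟨ +-comm y u ⟩
    u + y  ≤⟨ +-mono-≤ y u≤w ⟩
    w + y  ≈⟨ +-comm w y ⟩
    y + w  ∎
    where open ≤-Reasoning

  x≤x+y : ∀ x {y} → 0# ≤ y → x ≤ (x + y)
  x≤x+y x {y} 0≤y = begin
    x       ≈⟨ +-identityʳ x ⟨
    x + 0#  ≤⟨ +-mono₂-≤ ≤-refl 0≤y ⟩
    x + y   ∎
    where open ≤-Reasoning

  x≤y⇒0≤y-x : ∀ {x y} → x ≤ y → 0# ≤ (y - x)
  x≤y⇒0≤y-x {x} {y} x≤y = begin
    0#     ≈⟨ -‿inverseʳ x ⟨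
    x - x  ≤⟨ +-mono-≤ (- x) x≤y ⟩
    y - x  ∎
    where open ≤-Reasoning

  x+[y-x]≈y : ∀ x y → x + (y - x) ≈ y
  x+[y-x]≈y x y = trans (sym (+-assoc x y (- x))) (xyx⁻¹≈y x y)

  -- Writing q = p + a and s = r + b, the difference of the two sides is a * b ≥ 0.
  rearrangement : ∀ {p q r s} → p ≤ q → r ≤ s → (p * s + q * r) ≤ (p * r + q * s)
  rearrangement {p} {q} {r} {s} p≤q r≤s = begin
    p * s + q * r
      ≈⟨ +-cong (*-congˡ (x+[y-x]≈y r s)) (*-congʳ (x+[y-x]≈y p q)) ⟨
    p * (r + b) + (p + a) * r
      ≤⟨ x≤x+y _ (*-nonneg (x≤y⇒0≤y-x p≤q) (x≤y⇒0≤y-x r≤s)) ⟩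
    p * (r + b) + (p + a) * r + a * b
      ≈⟨ expand p a r b ⟩
    p * r + (p + a) * (r + b)
      ≈⟨ +-congˡ (*-cong (x+[y-x]≈y p q) (x+[y-x]≈y r s)) ⟩
    p * r + q * s
      ∎
    where
    open ≤-Reasoning
    a = q - p
    b = s - r
    expand : ∀ p a r b → p * (r + b) + (p + a) * r + a * b ≈ p * r + (p + a) * (r + b)
    expand = solve 4 (λ p a r b →
      p :* (r :+ b) :+ (p :+ a) :* r :+ a :* b := p :* r :+ (p :+ a) :* (r :+ b)) refl

  max-min-rearrangement : ∀ x y u w → (x * u + y * w) ≤ (max x y * max u w + min x y * min u w)
  max-min-rearrangement x y u w with total x y | total u w
  ... | inj₁ _   | inj₁ _   = ≤-reflexive (+-comm _ _)
  ... | inj₁ x≤y | inj₂ w≤u = ≤-trans (rearrangement x≤y w≤u) (≤-reflexive (+-comm _ _))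
  ... | inj₂ y≤x | inj₁ u≤w = ≤-trans (≤-reflexive (+-comm _ _))
                                       (≤-trans (rearrangement y≤x u≤w) (≤-reflexive (+-comm _ _)))
  ... | inj₂ _   | inj₂ _   = ≤-refl

  max*min≈* : ∀ x y → max x y * min x y ≈ x * y
  max*min≈* x y with total x y
  ... | inj₁ _ = *-comm y x
  ... | inj₂ _ = refl

  min-comm : ∀ x y → min x y ≈ min y x
  min-comm x y with total x y | total y x
  ... | inj₁ x≤y | inj₁ y≤x = antisym x≤y y≤x
  ... | inj₁ _   | inj₂ _   = refl
  ... | inj₂ _   | inj₁ _   = refl
  ... | inj₂ y≤x | inj₂ x≤y = antisym y≤x x≤y

  ∑ : ∀ {a} {X : Set a} → List X → (X → Carrier) → Carrier
  ∑ xs h = foldr (λ x acc → h x + acc) 0# xs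

  module _ {a} {X : Set a} where

    ∑-cong : ∀ xs {h k : X → Carrier} → (∀ x → h x ≈ k x) → ∑ xs h ≈ ∑ xs k
    ∑-cong []       h≈k = refl
    ∑-cong (x ∷ xs) h≈k = +-cong (h≈k x) (∑-cong xs h≈k)

    ∑-mono-≤ : ∀ xs {h k : X → Carrier} → (∀ x → h x ≤ k x) → ∑ xs h ≤ ∑ xs k
    ∑-mono-≤ []       h≤k = ≤-refl
    ∑-mono-≤ (x ∷ xs) h≤k = +-mono₂-≤ (h≤k x) (∑-mono-≤ xs h≤k)

    ∑-zero : ∀ xs {h : X → Carrier} → (∀ x → h x ≈ 0#) → ∑ xs h ≈ 0#
    ∑-zero []       h≈0 = refl
    ∑-zero (x ∷ xs) h≈0 = trans (+-cong (h≈0 x) (∑-zero xs h≈0)) (+-identityˡ 0#)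

    ∑-distrib-+ : ∀ xs (h k : X → Carrier) → ∑ xs (λ x → h x + k x) ≈ ∑ xs h + ∑ xs k
    ∑-distrib-+ []       h k = sym (+-identityˡ 0#)
    ∑-distrib-+ (x ∷ xs) h k =
      trans (+-congˡ (∑-distrib-+ xs h k)) (interchange (h x) (k x) (∑ xs h) (∑ xs k))

    ∑-++ : ∀ xs ys (h : X → Carrier) → ∑ (xs ++ ys) h ≈ ∑ xs h + ∑ ys h
    ∑-++ []       ys h = sym (+-identityˡ (∑ ys h))
    ∑-++ (x ∷ xs) ys h = trans (+-congˡ (∑-++ xs ys h)) (sym (+-assoc (h x) (∑ xs h) (∑ ys h)))

  ∑-map : ∀ {a b} {X : Set a} {Y : Set b} (g : X → Y) xs (h : Y → Carrier) →
          ∑ (map g xs) h ≡ ∑ xs (λ x → h (g x))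
  ∑-map g xs h = foldr-map _ g 0# xs

  Σv-suc : ∀ d (h : Subset (suc d) → Carrier) → Σv (suc d) h ≈ Σv d (lower h) + Σv d (upper h)
  Σv-suc d h = trans (∑-++ (map (outside ∷_) (allSubsets d)) _ h)
    (+-cong (reflexive (∑-map (outside ∷_) (allSubsets d) h))
            (reflexive (∑-map (inside ∷_) (allSubsets d) h)))

  -- A is defined by a with on ∣ S △ T ∣ ≟ 1, which does not compute under x ∷_; these
  -- indicators of the Hamming distance do.
  [_≡0] [_≡1] : ℕ → Carrier
  [ zero ≡0]  = 1#
  [ suc _ ≡0] = 0#
  [ 1 ≡1]           = 1#
  [ zero ≡1]        = 0#
  [ suc (suc _) ≡1] = 0#

  [suc≡1]≡[≡0] : ∀ n → [ suc n ≡1] ≡ [ n ≡0]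
  [suc≡1]≡[≡0] zero    = ≡.refl
  [suc≡1]≡[≡0] (suc n) = ≡.refl

  [≢1≡1]≡0 : ∀ {n} → n ≢ 1 → [ n ≡1] ≡ 0#
  [≢1≡1]≡0 {zero}        _   = ≡.refl
  [≢1≡1]≡0 {1}           n≢1 = ⊥-elim (n≢1 ≡.refl)
  [≢1≡1]≡0 {suc (suc _)} _   = ≡.refl

  A≡[∣△∣≡1] : ∀ {d} (S T : Subset d) → A S T ≡ [ ∣ S △ T ∣ ≡1]
  A≡[∣△∣≡1] S T with ∣ S △ T ∣ ≟ 1
  ... | yes ∣S△T∣≡1 = ≡.cong [_≡1] (≡.sym ∣S△T∣≡1)
  ... | no  ∣S△T∣≢1 = ≡.sym ([≢1≡1]≡0 ∣S△T∣≢1)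

  δ : ∀ {d} → Subset d → Subset d → Carrier
  δ S T = [ ∣ S △ T ∣ ≡0]

  A-∷-same : ∀ {d} x (S T : Subset d) → A (x ∷ S) (x ∷ T) ≡ A S T
  A-∷-same outside S T = ≡.trans (A≡[∣△∣≡1] (outside ∷ S) (outside ∷ T)) (≡.sym (A≡[∣△∣≡1] S T))
  A-∷-same inside  S T = ≡.trans (A≡[∣△∣≡1] (inside ∷ S) (inside ∷ T)) (≡.sym (A≡[∣△∣≡1] S T))

  A-∷-flip : ∀ {d} x (S T : Subset d) → A (x ∷ S) (not x ∷ T) ≡ δ S T
  A-∷-flip outside S T = ≡.trans (A≡[∣△∣≡1] (outside ∷ S) (inside ∷ T)) ([suc≡1]≡[≡0] ∣ S △ T ∣)
  A-∷-flip inside  S T = ≡.trans (A≡[∣△∣≡1] (inside ∷ S) (outside ∷ T)) ([suc≡1]≡[≡0] ∣ S △ T ∣)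

  Σv-δ : ∀ d (u : Subset d → Carrier) S → Σv d (λ T → δ S T * u T) ≈ u S
  Σv-δ zero    u []            = trans (+-identityʳ _) (*-identityˡ (u []))
  Σv-δ (suc d) u (outside ∷ S) = begin
    Σv (suc d) (λ T → δ (outside ∷ S) T * u T)
      ≈⟨ Σv-suc d _ ⟩
    Σv d (λ T → δ S T * lower u T) + Σv d (λ T → 0# * upper u T)
      ≈⟨ +-cong (Σv-δ d (lower u) S) (∑-zero (allSubsets d) (λ T → zeroˡ (upper u T))) ⟩
    lower u S + 0#
      ≈⟨ +-identityʳ _ ⟩
    u (outside ∷ S)
      ∎
    where open ≈-Reasoning
  Σv-δ (suc d) u (inside ∷ S) = begin
    Σv (suc d) (λ T → δ (inside ∷ S) T * u T)
      ≈⟨ Σv-suc d _ ⟩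
    Σv d (λ T → 0# * lower u T) + Σv d (λ T → δ S T * upper u T)
      ≈⟨ +-cong (∑-zero (allSubsets d) (λ T → zeroˡ (lower u T))) (Σv-δ d (upper u) S) ⟩
    0# + upper u S
      ≈⟨ +-identityˡ _ ⟩
    u (inside ∷ S)
      ∎
    where open ≈-Reasoning

  mulA-outside : ∀ d u S → mulA (suc d) u (outside ∷ S) ≈ mulA d (lower u) S + upper u S
  mulA-outside d u S = trans (Σv-suc d _) (+-cong
    (∑-cong (allSubsets d) (λ T → *-congʳ (reflexive (A-∷-same outside S T))))
    (trans (∑-cong (allSubsets d) (λ T → *-congʳ (reflexive (A-∷-flip outside S T))))
           (Σv-δ d (upper u) S)))

  mulA-inside : ∀ d u S → mulA (suc d) u (inside ∷ S) ≈ lower u S + mulA d (upper u) S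
  mulA-inside d u S = trans (Σv-suc d _) (+-cong
    (trans (∑-cong (allSubsets d) (λ T → *-congʳ (reflexive (A-∷-flip inside S T))))
           (Σv-δ d (lower u) S))
    (∑-cong (allSubsets d) (λ T → *-congʳ (reflexive (A-∷-same inside S T)))))

  infix 4 _≐_
  _≐_ : ∀ {d} → (Subset d → Carrier) → (Subset d → Carrier) → Set ℓ
  u ≐ w = ∀ S → u S ≈ w S

  _⊔_ _⊓_ : ∀ {d} → (Subset d → Carrier) → (Subset d → Carrier) → Subset d → Carrier
  (u ⊔ w) S = max (u S) (w S)
  (u ⊓ w) S = min (u S) (w S)

  ⟨⟩-cong : ∀ {d} {a a′ b b′ : Subset d → Carrier} → a ≐ a′ → b ≐ b′ → ⟨ a , b ⟩ ≈ ⟨ a′ , b′ ⟩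
  ⟨⟩-cong {d} a≐a′ b≐b′ = ∑-cong (allSubsets d) (λ S → *-cong (a≐a′ S) (b≐b′ S))

  ⟨⟩-comm : ∀ {d} (a b : Subset d → Carrier) → ⟨ a , b ⟩ ≈ ⟨ b , a ⟩
  ⟨⟩-comm {d} a b = ∑-cong (allSubsets d) (λ S → *-comm (a S) (b S))

  ⟨⟩-distribʳ-+ : ∀ {d} (a b c : Subset d → Carrier) →
                  ⟨ (λ S → a S + b S) , c ⟩ ≈ ⟨ a , c ⟩ + ⟨ b , c ⟩
  ⟨⟩-distribʳ-+ {d} a b c =
    trans (∑-cong (allSubsets d) (λ S → distribʳ (c S) (a S) (b S))) (∑-distrib-+ (allSubsets d) _ _)

  ⟨⟩-suc : ∀ {d} (a b : Subset (suc d) → Carrier) →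
           ⟨ a , b ⟩ ≈ ⟨ lower a , lower b ⟩ + ⟨ upper a , upper b ⟩
  ⟨⟩-suc {d} a b = Σv-suc d _

  ⟨⊔,⊓⟩≈⟨,⟩ : ∀ {d} (a b : Subset d → Carrier) → ⟨ a ⊔ b , a ⊓ b ⟩ ≈ ⟨ a , b ⟩
  ⟨⊔,⊓⟩≈⟨,⟩ {d} a b = ∑-cong (allSubsets d) (λ S → max*min≈* (a S) (b S))

  ⟨⟩-rearrangement : ∀ {d} (p q r s : Subset d → Carrier) →
                     (⟨ p , r ⟩ + ⟨ q , s ⟩) ≤ (⟨ p ⊔ q , r ⊔ s ⟩ + ⟨ p ⊓ q , r ⊓ s ⟩)
  ⟨⟩-rearrangement {d} p q r s = begin
    ⟨ p , r ⟩ + ⟨ q , s ⟩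
      ≈⟨ ∑-distrib-+ (allSubsets d) _ _ ⟨
    Σv d (λ S → p S * r S + q S * s S)
      ≤⟨ ∑-mono-≤ (allSubsets d) (λ S → max-min-rearrangement (p S) (q S) (r S) (s S)) ⟩
    Σv d (λ S → (p ⊔ q) S * (r ⊔ s) S + (p ⊓ q) S * (r ⊓ s) S)
      ≈⟨ ∑-distrib-+ (allSubsets d) _ _ ⟩
    ⟨ p ⊔ q , r ⊔ s ⟩ + ⟨ p ⊓ q , r ⊓ s ⟩
      ∎
    where open ≤-Reasoning

  quadA : ∀ d → (Subset d → Carrier) → Carrier
  quadA d v = ⟨ mulA d v , v ⟩

  quadA-cong : ∀ d {u w : Subset d → Carrier} → u ≐ w → quadA d u ≈ quadA d w
  quadA-cong d u≐w = ⟨⟩-cong (λ S → ∑-cong (allSubsets d) (λ T → *-congˡ (u≐w T))) u≐w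

  quadA-zero : ∀ v → quadA 0 v ≈ 0#
  quadA-zero v =
    trans (+-identityʳ _) (trans (*-congʳ (trans (+-identityʳ _) (zeroˡ (v [])))) (zeroˡ (v [])))

  quadA-suc : ∀ d (v : Subset (suc d) → Carrier) →
              quadA (suc d) v ≈ (quadA d (lower v) + quadA d (upper v)) +
                                (⟨ lower v , upper v ⟩ + ⟨ lower v , upper v ⟩)
  quadA-suc d v = begin
    quadA (suc d) v
      ≈⟨ ⟨⟩-suc (mulA (suc d) v) v ⟩
    ⟨ lower (mulA (suc d) v) , v₀ ⟩ + ⟨ upper (mulA (suc d) v) , v₁ ⟩
      ≈⟨ +-cong (⟨⟩-cong (mulA-outside d v) (λ _ → refl)) (⟨⟩-cong (mulA-inside d v) (λ _ → refl)) ⟩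
    ⟨ (λ S → mulA d v₀ S + v₁ S) , v₀ ⟩ + ⟨ (λ S → v₀ S + mulA d v₁ S) , v₁ ⟩
      ≈⟨ +-cong (⟨⟩-distribʳ-+ (mulA d v₀) v₁ v₀) (⟨⟩-distribʳ-+ v₀ (mulA d v₁) v₁) ⟩
    (quadA d v₀ + ⟨ v₁ , v₀ ⟩) + (⟨ v₀ , v₁ ⟩ + quadA d v₁)
      ≈⟨ +-cong (+-congˡ (⟨⟩-comm v₁ v₀)) (+-comm _ _) ⟩
    (quadA d v₀ + ⟨ v₀ , v₁ ⟩) + (quadA d v₁ + ⟨ v₀ , v₁ ⟩)
      ≈⟨ interchange _ _ _ _ ⟩
    (quadA d v₀ + quadA d v₁) + (⟨ v₀ , v₁ ⟩ + ⟨ v₀ , v₁ ⟩)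
      ∎
    where
    open ≈-Reasoning
    v₀ = lower v
    v₁ = upper v

  quadA-suc-≐ : ∀ d {v : Subset (suc d) → Carrier} {v₀ v₁ : Subset d → Carrier} →
                lower v ≐ v₀ → upper v ≐ v₁ →
                quadA (suc d) v ≈ (quadA d v₀ + quadA d v₁) + (⟨ v₀ , v₁ ⟩ + ⟨ v₀ , v₁ ⟩)
  quadA-suc-≐ d {v} lower≐v₀ upper≐v₁ = trans (quadA-suc d v)
    (+-cong (+-cong (quadA-cong d lower≐v₀) (quadA-cong d upper≐v₁)) (+-cong cross cross))
    where cross = ⟨⟩-cong lower≐v₀ upper≐v₁

  quadA-supermodular : ∀ d (a b : Subset d → Carrier) →
                       (quadA d a + quadA d b) ≤ (quadA d (a ⊔ b) + quadA d (a ⊓ b))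
  quadA-supermodular zero a b = ≤-reflexive (begin
    quadA 0 a + quadA 0 b              ≈⟨ +-cong (quadA-zero a) (quadA-zero b) ⟩
    0# + 0#                            ≈⟨ +-cong (quadA-zero (a ⊔ b)) (quadA-zero (a ⊓ b)) ⟨
    quadA 0 (a ⊔ b) + quadA 0 (a ⊓ b)  ∎)
    where open ≈-Reasoning
  quadA-supermodular (suc d) a b = begin
    quadA (suc d) a + quadA (suc d) b
      ≈⟨ +-cong (quadA-suc d a) (quadA-suc d b) ⟩
    ((q a₀ + q a₁) + (⟨ a₀ , a₁ ⟩ + ⟨ a₀ , a₁ ⟩)) + ((q b₀ + q b₁) + (⟨ b₀ , b₁ ⟩ + ⟨ b₀ , b₁ ⟩))
      ≈⟨ regroup _ _ _ _ _ _ ⟩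
    ((q a₀ + q b₀) + (q a₁ + q b₁)) + ((⟨ a₀ , a₁ ⟩ + ⟨ b₀ , b₁ ⟩) + (⟨ a₀ , a₁ ⟩ + ⟨ b₀ , b₁ ⟩))
      ≤⟨ +-mono₂-≤ (+-mono₂-≤ (quadA-supermodular d a₀ b₀) (quadA-supermodular d a₁ b₁))
                   (+-mono₂-≤ cross cross) ⟩
    ((q (a₀ ⊔ b₀) + q (a₀ ⊓ b₀)) + (q (a₁ ⊔ b₁) + q (a₁ ⊓ b₁))) + ((x⊔ + x⊓) + (x⊔ + x⊓))
      ≈⟨ regroup _ _ _ _ _ _ ⟨
    ((q (a₀ ⊔ b₀) + q (a₁ ⊔ b₁)) + (x⊔ + x⊔)) + ((q (a₀ ⊓ b₀) + q (a₁ ⊓ b₁)) + (x⊓ + x⊓))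
      ≈⟨ +-cong (quadA-suc d (a ⊔ b)) (quadA-suc d (a ⊓ b)) ⟨
    quadA (suc d) (a ⊔ b) + quadA (suc d) (a ⊓ b)
      ∎
    where
    open ≤-Reasoning
    q = quadA d
    a₀ = lower a
    a₁ = upper a
    b₀ = lower b
    b₁ = upper b
    x⊔ = ⟨ a₀ ⊔ b₀ , a₁ ⊔ b₁ ⟩
    x⊓ = ⟨ a₀ ⊓ b₀ , a₁ ⊓ b₁ ⟩
    cross : (⟨ a₀ , a₁ ⟩ + ⟨ b₀ , b₁ ⟩) ≤ (x⊔ + x⊓)
    cross = ⟨⟩-rearrangement a₀ b₀ a₁ b₁
    regroup : ∀ x y z x′ y′ z′ → ((x + y) + (z + z)) + ((x′ + y′) + (z′ + z′)) ≈
                                 ((x + x′) + (y + y′)) + ((z + z′) + (z + z′))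
    regroup x y z x′ y′ z′ =
      trans (interchange _ _ _ _) (+-cong (interchange x y x′ y′) (interchange z z z′ z′))

  lower-compress-zero : ∀ d (v : Subset (suc d) → Carrier) →
                        lower (compress (suc d) zero v) ≐ lower v ⊔ upper v
  lower-compress-zero d v S =
    reflexive (≡.cong (λ T → max (v (outside ∷ S)) (v (inside ∷ T))) (∪-identityʳ S))

  upper-compress-zero : ∀ d (v : Subset (suc d) → Carrier) →
                        upper (compress (suc d) zero v) ≐ lower v ⊓ upper v
  upper-compress-zero d v S =
    trans (reflexive (≡.cong (λ T → min (v (inside ∷ S)) (v (outside ∷ T))) (p─⊥≡p S))) (min-comm _ _)

  compress-suc-∷ : ∀ d j (v : Subset (suc d) → Carrier) x →
                   (λ S → compress (suc d) (suc j) v (x ∷ S)) ≐ compress d j (λ S → v (x ∷ S))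
  compress-suc-∷ d j v outside S with lookup S j
  ... | outside = refl
  ... | inside  = refl
  compress-suc-∷ d j v inside  S with lookup S j
  ... | outside = refl
  ... | inside  = refl

  ⟨⟩-≤-compress : ∀ d i (a b : Subset d → Carrier) → ⟨ a , b ⟩ ≤ ⟨ compress d i a , compress d i b ⟩
  ⟨⟩-≤-compress (suc d) zero a b = begin
    ⟨ a , b ⟩
      ≈⟨ ⟨⟩-suc a b ⟩
    ⟨ lower a , lower b ⟩ + ⟨ upper a , upper b ⟩
      ≤⟨ ⟨⟩-rearrangement (lower a) (upper a) (lower b) (upper b) ⟩
    ⟨ lower a ⊔ upper a , lower b ⊔ upper b ⟩ + ⟨ lower a ⊓ upper a , lower b ⊓ upper b ⟩
      ≈⟨ +-cong (⟨⟩-cong (lower-compress-zero d a) (lower-compress-zero d b))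
                (⟨⟩-cong (upper-compress-zero d a) (upper-compress-zero d b)) ⟨
    ⟨ lower (C a) , lower (C b) ⟩ + ⟨ upper (C a) , upper (C b) ⟩
      ≈⟨ ⟨⟩-suc (C a) (C b) ⟨
    ⟨ C a , C b ⟩
      ∎
    where
    open ≤-Reasoning
    C = compress (suc d) zero
  ⟨⟩-≤-compress (suc d) (suc j) a b = begin
    ⟨ a , b ⟩
      ≈⟨ ⟨⟩-suc a b ⟩
    ⟨ lower a , lower b ⟩ + ⟨ upper a , upper b ⟩
      ≤⟨ +-mono₂-≤ (⟨⟩-≤-compress d j (lower a) (lower b)) (⟨⟩-≤-compress d j (upper a) (upper b)) ⟩
    ⟨ C (lower a) , C (lower b) ⟩ + ⟨ C (upper a) , C (upper b) ⟩
      ≈⟨ +-cong (⟨⟩-cong (compress-suc-∷ d j a outside) (compress-suc-∷ d j b outside))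
                (⟨⟩-cong (compress-suc-∷ d j a inside) (compress-suc-∷ d j b inside)) ⟨
    ⟨ lower (C′ a) , lower (C′ b) ⟩ + ⟨ upper (C′ a) , upper (C′ b) ⟩
      ≈⟨ ⟨⟩-suc (C′ a) (C′ b) ⟨
    ⟨ C′ a , C′ b ⟩
      ∎
    where
    open ≤-Reasoning
    C = compress d j
    C′ = compress (suc d) (suc j)

  quadA-≤-compress : ∀ d i (v : Subset d → Carrier) → quadA d v ≤ quadA d (compress d i v)
  quadA-≤-compress (suc d) zero v = begin
    quadA (suc d) v
      ≈⟨ quadA-suc d v ⟩
    (quadA d v₀ + quadA d v₁) + (⟨ v₀ , v₁ ⟩ + ⟨ v₀ , v₁ ⟩)
      ≤⟨ +-mono₂-≤ (quadA-supermodular d v₀ v₁) (≤-reflexive (+-cong cross cross)) ⟩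
    (quadA d (v₀ ⊔ v₁) + quadA d (v₀ ⊓ v₁)) + (⟨ v₀ ⊔ v₁ , v₀ ⊓ v₁ ⟩ + ⟨ v₀ ⊔ v₁ , v₀ ⊓ v₁ ⟩)
      ≈⟨ quadA-suc-≐ d (lower-compress-zero d v) (upper-compress-zero d v) ⟨
    quadA (suc d) (compress (suc d) zero v)
      ∎
    where
    open ≤-Reasoning
    v₀ = lower v
    v₁ = upper v
    cross = sym (⟨⊔,⊓⟩≈⟨,⟩ v₀ v₁)
  quadA-≤-compress (suc d) (suc j) v = begin
    quadA (suc d) v
      ≈⟨ quadA-suc d v ⟩
    (quadA d v₀ + quadA d v₁) + (⟨ v₀ , v₁ ⟩ + ⟨ v₀ , v₁ ⟩)
      ≤⟨ +-mono₂-≤ (+-mono₂-≤ (quadA-≤-compress d j v₀) (quadA-≤-compress d j v₁))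
                   (+-mono₂-≤ cross cross) ⟩
    (quadA d (C v₀) + quadA d (C v₁)) + (⟨ C v₀ , C v₁ ⟩ + ⟨ C v₀ , C v₁ ⟩)
      ≈⟨ quadA-suc-≐ d (compress-suc-∷ d j v outside) (compress-suc-∷ d j v inside) ⟨
    quadA (suc d) (compress (suc d) (suc j) v)
      ∎
    where
    open ≤-Reasoning
    v₀ = lower v
    v₁ = upper v
    C = compress d j
    cross = ⟨⟩-≤-compress d j v₀ v₁

lemma2p1 : {c ℓ : Level} (R : RealField c ℓ) (d : ℕ) (i : Fin d)
           (v : Subset d → RealField.Carrier R) →
           let open RealField R in let open Cube R in
           ⟨ mulA d v , v ⟩ ≤ ⟨ mulA d (compress d i v) , compress d i v ⟩
lemma2p1 R = Compression.quadA-≤-compress R
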